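{- Let $A$ be a set equipped with a ternary operation $p\colon A^3\to A$ and two constants $0,1\in A$ such that for all $a,b,c,b_1,b_2,b_3\in A$: (C1) $p(0,a,1)=a$; (C2) $p(a,b,a)=a$; (C3) $p(a,p(b_1,b_2,b_3),c)=p(p(a,b_1,c),b_2,p(a,b_3,c))$; (C4) $p(a,0,b)=a=p(b,1,a)$. Define $a\wedge b=p(0,a,b)$ and $a\vee b=p(a,b,1)$. If the operations $\wedge$ and $\vee$ are both commutative and idempotent, then they distribute over each other, i.e. for all $a,b,c\in A$, $(b\vee c)\wedge a=(b\wedge a)\vee(c\wedge a)$ and $a\vee(b\wedge c)=(a\vee b)\wedge(a\vee c)$. -}

module Defs where

open import Level using (Level; suc)
open import Relation.Binary.PropositionalEquality using (_≡_)
open import Data.Product using (_×_)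

record C-algebra {a : Level} (A : Set a) : Set a where
  field
    p   : A → A → A → A
    𝟘   : A
    𝟙   : A
    C1  : ∀ x → p 𝟘 x 𝟙 ≡ x
    C2  : ∀ x y → p x y x ≡ x
    C3  : ∀ x y₁ y₂ y₃ z → p x (p y₁ y₂ y₃) z ≡ p (p x y₁ z) y₂ (p x y₃ z)
    C4  : ∀ x y → (p x 𝟘 y ≡ x) × (p y 𝟙 x ≡ x)

  _∧_ : A → A → A
  x ∧ y = p 𝟘 x y

  _∨_ : A → A → A
  x ∨ y = p x y 𝟙

  infixr 6 _∧_
  infixr 5 _∨_

{-# OPTIONS --safe #-}
-- Instances of (C3) with outer arguments 𝟘 _ w, resp. x _ 𝟙, say that _∧ w
-- and x ∨_ distribute over p. Since b ∨ c = p b c 𝟙 and b ∧ c = p 𝟘 b c, both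
-- distributive laws then reduce to an absorption law, which (C2) yields once
-- the middle argument of p has been made idempotent.
module Submission where

open import Defs
open import Relation.Binary.PropositionalEquality using (_≡_; cong; cong₂; sym; trans; module ≡-Reasoning)
open import Data.Product using (_×_; _,_; proj₁; proj₂)

module C-algebraProperties {ℓ} {A : Set ℓ} (C : C-algebra A) where

  open C-algebra C
  open import Algebra.Definitions (_≡_ {A = A})
  open ≡-Reasoning

  ∧-identityˡ : LeftIdentity 𝟙 _∧_
  ∧-identityˡ x = proj₂ (C4 x 𝟘)

  ∨-identityʳ : RightIdentity 𝟘 _∨_
  ∨-identityʳ x = proj₁ (C4 x 𝟙)

  ∧-distribʳ-p : ∀ w x y z → p x y z ∧ w ≡ p (x ∧ w) y (z ∧ w)
  ∧-distribʳ-p w x y z = C3 𝟘 x y z w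

  ∨-distribˡ-p : ∀ w x y z → w ∨ p x y z ≡ p (w ∨ x) y (w ∨ z)
  ∨-distribˡ-p w x y z = C3 w x y z 𝟙

  ∨-absorbed-by-∧ : Idempotent _∧_ → ∀ x y → (x ∨ y) ∧ x ≡ x
  ∨-absorbed-by-∧ ∧-idem x y = begin
    (x ∨ y) ∧ x          ≡⟨ ∧-distribʳ-p x x y 𝟙 ⟩
    p (x ∧ x) y (𝟙 ∧ x)  ≡⟨ cong₂ (λ u v → p u y v) (∧-idem x) (∧-identityˡ x) ⟩
    p x y x              ≡⟨ C2 x y ⟩
    x                    ∎

  ∧-absorbed-by-∨ : Idempotent _∨_ → ∀ x y → x ∨ (y ∧ x) ≡ x
  ∧-absorbed-by-∨ ∨-idem x y = begin
    x ∨ (y ∧ x)          ≡⟨ ∨-distribˡ-p x 𝟘 y x ⟩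
    p (x ∨ 𝟘) y (x ∨ x)  ≡⟨ cong₂ (λ u v → p u y v) (∨-identityʳ x) (∨-idem x) ⟩
    p x y x              ≡⟨ C2 x y ⟩
    x                    ∎

  ∧-distribʳ-∨ : Commutative _∨_ → Idempotent _∨_ → _∧_ DistributesOverʳ _∨_
  ∧-distribʳ-∨ ∨-comm ∨-idem a b c = begin
    (b ∨ c) ∧ a                       ≡⟨ ∧-distribʳ-p a b c 𝟙 ⟩
    p (b ∧ a) c (𝟙 ∧ a)               ≡⟨ cong (p (b ∧ a) c) (∧-identityˡ a) ⟩
    p (b ∧ a) c a                     ≡⟨ cong₂ (λ u v → p u c v) (sym (∨-identityʳ (b ∧ a))) (sym absorb) ⟩
    p ((b ∧ a) ∨ 𝟘) c ((b ∧ a) ∨ a)   ≡⟨ sym (∨-distribˡ-p (b ∧ a) 𝟘 c a) ⟩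
    (b ∧ a) ∨ (c ∧ a)                 ∎
    where
    absorb : (b ∧ a) ∨ a ≡ a
    absorb = trans (∨-comm (b ∧ a) a) (∧-absorbed-by-∨ ∨-idem a b)

  ∨-distribˡ-∧ : Commutative _∧_ → Idempotent _∧_ → _∨_ DistributesOverˡ _∧_
  ∨-distribˡ-∧ ∧-comm ∧-idem a b c = begin
    a ∨ (b ∧ c)                       ≡⟨ ∨-distribˡ-p a 𝟘 b c ⟩
    p (a ∨ 𝟘) b (a ∨ c)               ≡⟨ cong (λ u → p u b (a ∨ c)) (∨-identityʳ a) ⟩
    p a b (a ∨ c)                     ≡⟨ cong₂ (λ u v → p u b v) (sym absorb) (sym (∧-identityˡ (a ∨ c))) ⟩
    p (a ∧ (a ∨ c)) b (𝟙 ∧ (a ∨ c))   ≡⟨ sym (∧-distribʳ-p (a ∨ c) a b 𝟙) ⟩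
    (a ∨ b) ∧ (a ∨ c)                 ∎
    where
    absorb : a ∧ (a ∨ c) ≡ a
    absorb = trans (∧-comm a (a ∨ c)) (∨-absorbed-by-∧ ∧-idem a c)

lemma2 : ∀ {ℓ} {A : Set ℓ} (C : C-algebra A) →
    let open C-algebra C in
    (∀ x y → x ∧ y ≡ y ∧ x) → (∀ x → x ∧ x ≡ x) →
    (∀ x y → x ∨ y ≡ y ∨ x) → (∀ x → x ∨ x ≡ x) →
    (∀ a b c → (b ∨ c) ∧ a ≡ (b ∧ a) ∨ (c ∧ a))
    × (∀ a b c → a ∨ (b ∧ c) ≡ (a ∨ b) ∧ (a ∨ c))
lemma2 C ∧-comm ∧-idem ∨-comm ∨-idem =
  ∧-distribʳ-∨ ∨-comm ∨-idem , ∨-distribˡ-∧ ∧-comm ∧-idem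
  where open C-algebraProperties C
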